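{- Let $n \ge 1$, let $W$ be the $\{0,1\}$ inclusion matrix of $E(K_{n,n,n})$ versus $T(K_{n,n,n})$, and let $M = WW^\top$. Then $\operatorname{rank}(W) = \operatorname{rank}(M) = n^3 - (n-1)^3$.
   Context: $K_{n,n,n}$ is the complete $3$-partite graph with three parts of size $n$. For a graph $G$, $T(G)$ is the set of triangles of $G$, and the inclusion matrix of $E(G)$ versus $T(G)$ has rows indexed by edges, columns indexed by triangles, and $(e,t)$-entry equal to $1$ if $e \subseteq t$ and $0$ otherwise. Ranks are over $\mathbb{R}$.
   Formalization: The ranks of W and M are taken over ℚ instead of ℝ, so linear independence of columns is tested only with rational coefficients. -}

module Defs where

open import Data.Nat using (ℕ; zero; suc; _<_)
open import Data.Fin using (Fin; toℕ) renaming (zero to fz; suc to fs)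
import Data.Fin as F
open import Data.Product using (Σ; _×_; _,_; proj₁; proj₂)
open import Data.Bool using (Bool; true; false; if_then_else_; _∧_)
open import Data.Rational using (ℚ; 0ℚ; 1ℚ; _+_; _*_)
open import Relation.Nullary using (¬_)
open import Relation.Nullary.Decidable using (⌊_⌋)
open import Relation.Binary.PropositionalEquality using (_≡_)
open import Function.Definitions using (Injective)

sumFin : ∀ {r} → (Fin r → ℚ) → ℚ
sumFin {zero}  f = 0ℚ
sumFin {suc r} f = f fz + sumFin (λ i → f (fs i))

Matrix : Set → Set → Set
Matrix R C = R → C → ℚ

LinIndepCols : ∀ {R C : Set} → Matrix R C → ∀ {r} → (Fin r → C) → Set
LinIndepCols {R} A {r} f =
  (c : Fin r → ℚ) →
  (∀ (x : R) → sumFin (λ i → c i * A x (f i)) ≡ 0ℚ) →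
  ∀ i → c i ≡ 0ℚ

HasRank : ∀ {R C : Set} → Matrix R C → ℕ → Set
HasRank {R} {C} A r =
  (Σ (Fin r → C) λ f → Injective _≡_ _≡_ f × LinIndepCols A f)
  × (∀ (f : Fin (suc r) → C) → Injective _≡_ _≡_ f → ¬ LinIndepCols A f)

-- Vertex (p , a): the a-th vertex of part p.
Vertex : ℕ → Set
Vertex n = Fin 3 × Fin n

part : ∀ {n} → Vertex n → Fin 3
part = proj₁

-- Edges: unordered pairs {u,v} of vertices in different parts,
-- represented uniquely with part u < part v.
record Edge (n : ℕ) : Set where
  constructor edge
  field
    u v : Vertex n
    ord : toℕ (part u) < toℕ (part v)

-- Triangles: exactly one vertex from each part; vertex (p , t p).
Triangle : ℕ → Set
Triangle n = Fin 3 → Fin n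

_∈T?_ : ∀ {n} → Vertex n → Triangle n → Bool
(p , a) ∈T? t = ⌊ t p F.≟ a ⌋

W : (n : ℕ) → Matrix (Edge n) (Triangle n)
W n e t = if (Edge.u e ∈T? t) ∧ (Edge.v e ∈T? t) then 1ℚ else 0ℚ

sumTri : ∀ {n} → (Triangle n → ℚ) → ℚ
sumTri {n} g = sumFin λ a → sumFin λ b → sumFin λ c →
  g (λ { fz → a ; (fs fz) → b ; (fs (fs fz)) → c })

M : (n : ℕ) → Matrix (Edge n) (Edge n)
M n e e' = sumTri λ t → W n e t * W n e' t

-- Let B be the set of triangles of K_{n,n,n} through at least one of the three vertices numbered 0,
-- so |B| = n³ − (n−1)³, graded by the position of the last zero coordinate.  Each t ∈ B has an edge
-- lying in no other triangle of B of the same or lower level, so the columns of W indexed by B are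
-- independent (a unitriangular minor), and so are the rows of W indexed by these edges.  An edge sees
-- only two coordinates of a triangle, so by inclusion–exclusion the column of (a,b,c) is the signed
-- sum of the columns of (a,b,0), (a,0,c), (0,b,c), (a,0,0), (0,b,0), (0,0,c), (0,0,0), all in B;
-- as r + 1 vectors in the span of r are dependent, rank W = |B|.  The columns of M = W Wᵀ lie in the
-- column space of W, and a relation Σ c_e M(·,e) = 0 among the chosen edges gives
-- Σ_t (Σ_e c_e W(e,t))² = 0, hence a relation among the chosen rows of W, so rank M = |B| as well.

module Submission where

open import Defs
open import Data.Nat as ℕ using (ℕ; zero; suc; _^_; _∸_; _<_; z≤n; s≤s)
open import Data.Nat.Properties using (∸-monoʳ-<; m+n∸n≡m)
open import Data.Nat.Induction using (<-wellFounded)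
open import Data.Nat.Tactic.RingSolver using (solve-∀)
open import Data.Fin as F using (Fin; punchIn)
open import Data.Fin.Patterns using (0F; 1F; 2F)
open import Data.Fin.Properties using (all?; ¬∀⟶∃¬; punchInᵢ≢i; +↔⊎; *↔×)
open import Data.Vec.Functional using (insertAt)
open import Data.Vec.Functional.Properties using (insertAt-lookup; insertAt-punchIn)
open import Data.Product using (Σ; ∃; _×_; _,_)
open import Data.Sum using (_⊎_; inj₁; inj₂; [_,_]′)
open import Data.Sum.Function.Propositional using (_⊎-↔_)
open import Data.Empty using (⊥-elim)
open import Data.Unit using (tt)
open import Data.Bool using (true; false; if_then_else_; _∧_; T)
import Data.Integer as ℤ
open import Data.Rational using (ℚ; 0ℚ; 1ℚ; _+_; _*_; -_; _-_; 1/_; _≤_; NonZero; ≢-nonZero; mkℚ)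
open import Data.Rational.Properties
open import Data.Rational.Solver using (module +-*-Solver)
open import Algebra.Bundles using (CommutativeRing; CommutativeMonoid)
open import Algebra.Properties.Semiring.Sum (CommutativeRing.semiring +-*-commutativeRing)
  using (sum; sum-cong-≗; sum-replicate-zero; sum-remove; ∑-distrib-+; ∑-comm; *-distribˡ-sum; *-distribʳ-sum)
open import Algebra.Properties.CommutativeSemigroup (CommutativeMonoid.commutativeSemigroup *-1-commutativeMonoid)
  using (x∙yz≈y∙xz)
open import Algebra.Apartness.Properties.HeytingCommutativeRing heytingCommutativeRing
  using (x#0y#0→xy#0)
open import Induction.WellFounded using (module All)
import Relation.Binary.Construct.On as On
open import Relation.Nullary using (¬_; yes; no; does)
open import Relation.Nullary.Decidable using (⌊_⌋; toWitness; isYes≗does; dec-true; dec-false)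
open import Relation.Binary.PropositionalEquality
open import Function.Base using (id; _∘_)
open import Function.Bundles using (_↔_; Inverse)
open import Function.Definitions using (Injective)
open import Function.Properties.Inverse using (↔-trans)

open ≡-Reasoning
open +-*-Solver

private
  variable
    k r : ℕ
    R C : Set

p*q≡0⇒p≡0∨q≡0 : ∀ p q → p * q ≡ 0ℚ → p ≡ 0ℚ ⊎ q ≡ 0ℚ
p*q≡0⇒p≡0∨q≡0 p q pq≡0 with p ≟ 0ℚ | q ≟ 0ℚ
... | yes p≡0 | _       = inj₁ p≡0
... | no _    | yes q≡0 = inj₂ q≡0
... | no p≢0  | no q≢0  = ⊥-elim (x#0y#0→xy#0 p≢0 q≢0 pq≡0)

p*p≡0⇒p≡0 : ∀ p → p * p ≡ 0ℚ → p ≡ 0ℚ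
p*p≡0⇒p≡0 p pp≡0 = [ id , id ]′ (p*q≡0⇒p≡0∨q≡0 p p pp≡0)

p*p≥0 : ∀ p → 0ℚ ≤ p * p
p*p≥0 p@(mkℚ (ℤ.+ _)    _ _) = nonNegative⁻¹ (p * p) {{nonNeg*nonNeg⇒nonNeg p p}}
p*p≥0 p@(mkℚ ℤ.-[1+ _ ] _ _) = nonNegative⁻¹ (p * p) {{nonPos*nonPos⇒nonPos p p}}

p+q≡0⇒p≡0∧q≡0 : ∀ {p q} → 0ℚ ≤ p → 0ℚ ≤ q → p + q ≡ 0ℚ → p ≡ 0ℚ × q ≡ 0ℚ
p+q≡0⇒p≡0∧q≡0 {p} {q} p≥0 q≥0 p+q≡0 = p≡0 , q≡0
  where
  p≡0 : p ≡ 0ℚ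
  p≡0 = ≤-antisym (≤-trans (≤-trans (≤-reflexive (sym (+-identityʳ p))) (+-monoʳ-≤ p q≥0))
                           (≤-reflexive p+q≡0)) p≥0
  q≡0 : q ≡ 0ℚ
  q≡0 = trans (sym (+-identityˡ q)) (trans (cong (_+ q) (sym p≡0)) p+q≡0)

sumFin≡sum : (f : Fin r → ℚ) → sumFin f ≡ sum f
sumFin≡sum {zero}  f = refl
sumFin≡sum {suc r} f = cong (f 0F +_) (sumFin≡sum (λ i → f (F.suc i)))

sumFin-cong : {f g : Fin r → ℚ} → (∀ i → f i ≡ g i) → sumFin f ≡ sumFin g
sumFin-cong {f = f} {g} f≗g = begin
  sumFin f ≡⟨ sumFin≡sum f ⟩
  sum f    ≡⟨ sum-cong-≗ f≗g ⟩
  sum g    ≡⟨ sumFin≡sum g ⟨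
  sumFin g ∎

sumFin-zero : {f : Fin r → ℚ} → (∀ i → f i ≡ 0ℚ) → sumFin f ≡ 0ℚ
sumFin-zero {r} f≗0 = trans (sumFin-cong f≗0) (trans (sumFin≡sum {r} (λ _ → 0ℚ)) (sum-replicate-zero r))

sumFin-remove : (f : Fin (suc r) → ℚ) (p : Fin (suc r)) →
  sumFin f ≡ f p + sumFin (λ j → f (punchIn p j))
sumFin-remove f p = begin
  sumFin f                             ≡⟨ sumFin≡sum f ⟩
  sum f                                ≡⟨ sum-remove {i = p} f ⟩
  f p + sum (λ j → f (punchIn p j))    ≡⟨ cong (f p +_) (sumFin≡sum (λ j → f (punchIn p j))) ⟨
  f p + sumFin (λ j → f (punchIn p j)) ∎

sumFin-single : (f : Fin r → ℚ) (p : Fin r) → (∀ i → i ≢ p → f i ≡ 0ℚ) → sumFin f ≡ f p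
sumFin-single {suc r} f p f≡0 = begin
  sumFin f                             ≡⟨ sumFin-remove f p ⟩
  f p + sumFin (λ j → f (punchIn p j)) ≡⟨ cong (f p +_) (sumFin-zero (λ j → f≡0 _ (punchInᵢ≢i p j))) ⟩
  f p + 0ℚ                             ≡⟨ +-identityʳ (f p) ⟩
  f p                                  ∎

sumFin-+ : (f g : Fin r → ℚ) → sumFin (λ i → f i + g i) ≡ sumFin f + sumFin g
sumFin-+ f g = begin
  sumFin (λ i → f i + g i) ≡⟨ sumFin≡sum (λ i → f i + g i) ⟩
  sum (λ i → f i + g i)    ≡⟨ ∑-distrib-+ f g ⟩
  sum f + sum g            ≡⟨ cong₂ _+_ (sumFin≡sum f) (sumFin≡sum g) ⟨
  sumFin f + sumFin g      ∎

sumFin-*ˡ : (a : ℚ) (f : Fin r → ℚ) → a * sumFin f ≡ sumFin (λ i → a * f i)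
sumFin-*ˡ a f = begin
  a * sumFin f           ≡⟨ cong (a *_) (sumFin≡sum f) ⟩
  a * sum f              ≡⟨ *-distribˡ-sum a f ⟩
  sum (λ i → a * f i)    ≡⟨ sumFin≡sum (λ i → a * f i) ⟨
  sumFin (λ i → a * f i) ∎

sumFin-*ʳ : (a : ℚ) (f : Fin r → ℚ) → sumFin f * a ≡ sumFin (λ i → f i * a)
sumFin-*ʳ a f = begin
  sumFin f * a           ≡⟨ cong (_* a) (sumFin≡sum f) ⟩
  sum f * a              ≡⟨ *-distribʳ-sum a f ⟩
  sum (λ i → f i * a)    ≡⟨ sumFin≡sum (λ i → f i * a) ⟨
  sumFin (λ i → f i * a) ∎

sumFin-comm : (f : Fin k → Fin r → ℚ) →
  sumFin (λ i → sumFin (f i)) ≡ sumFin (λ j → sumFin (λ i → f i j))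
sumFin-comm f = begin
  sumFin (λ i → sumFin (f i))         ≡⟨ sumFin-cong (λ i → sumFin≡sum (f i)) ⟩
  sumFin (λ i → sum (f i))            ≡⟨ sumFin≡sum (λ i → sum (f i)) ⟩
  sum (λ i → sum (f i))               ≡⟨ ∑-comm f ⟩
  sum (λ j → sum (λ i → f i j))       ≡⟨ sumFin≡sum (λ j → sum (λ i → f i j)) ⟨
  sumFin (λ j → sum (λ i → f i j))    ≡⟨ sumFin-cong (λ j → sumFin≡sum (λ i → f i j)) ⟨
  sumFin (λ j → sumFin (λ i → f i j)) ∎

sumFin-exchange : (c : Fin k → ℚ) (g : Fin k → Fin r → ℚ) →
  sumFin (λ j → c j * sumFin (g j)) ≡ sumFin (λ i → sumFin (λ j → c j * g j i))
sumFin-exchange c g =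
  trans (sumFin-cong (λ j → sumFin-*ˡ (c j) (g j))) (sumFin-comm (λ j i → c j * g j i))

sumFin-nonNeg : {f : Fin r → ℚ} → (∀ i → 0ℚ ≤ f i) → 0ℚ ≤ sumFin f
sumFin-nonNeg {zero}  f≥0 = ≤-refl
sumFin-nonNeg {suc r} f≥0 = +-mono-≤ (f≥0 0F) (sumFin-nonNeg (λ i → f≥0 (F.suc i)))

sumFin≡0⇒≡0 : {f : Fin r → ℚ} → (∀ i → 0ℚ ≤ f i) → sumFin f ≡ 0ℚ → ∀ i → f i ≡ 0ℚ
sumFin≡0⇒≡0 {suc r} f≥0 Σf≡0 i
  with p+q≡0⇒p≡0∧q≡0 (f≥0 0F) (sumFin-nonNeg (λ j → f≥0 (F.suc j))) Σf≡0
sumFin≡0⇒≡0 {suc r} f≥0 Σf≡0 0F       | f0≡0 , _    = f0≡0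
sumFin≡0⇒≡0 {suc r} f≥0 Σf≡0 (F.suc i) | _ , rest≡0 =
  sumFin≡0⇒≡0 (λ j → f≥0 (F.suc j)) rest≡0 i

Dependent : (Fin k → Fin r → ℚ) → Set
Dependent {k} v = Σ (Fin k → ℚ) λ c → (∃ λ j → c j ≢ 0ℚ) × (∀ i → sumFin (λ j → c j * v j i) ≡ 0ℚ)

pivot : (v : Fin (suc k) → Fin (suc r) → ℚ) →
  Σ (Fin (suc k)) λ p → Σ (Fin k → ℚ) λ μ → ∀ j → v (punchIn p j) 0F ≡ μ j * v p 0F
pivot v with all? (λ j → v j 0F ≟ 0ℚ)
... | yes v≡0 = 0F , (λ _ → 0ℚ) , λ j → trans (v≡0 (F.suc j)) (sym (*-zeroˡ (v 0F 0F)))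
... | no ¬v≡0 with ¬∀⟶∃¬ _ _ (λ j → v j 0F ≟ 0ℚ) ¬v≡0
...   | p , vp≢0 = p , (λ j → v (punchIn p j) 0F * 1/ v p 0F) , λ j → ratio (v (punchIn p j) 0F)
  where
  instance
    vp-nonZero : NonZero (v p 0F)
    vp-nonZero = ≢-nonZero vp≢0
  ratio : ∀ x → x ≡ x * 1/ v p 0F * v p 0F
  ratio x = sym (begin
    x * 1/ v p 0F * v p 0F   ≡⟨ *-assoc x _ _ ⟩
    x * (1/ v p 0F * v p 0F) ≡⟨ cong (x *_) (*-inverseˡ (v p 0F)) ⟩
    x * 1ℚ                   ≡⟨ *-identityʳ x ⟩
    x                        ∎)

-- One step of Gaussian elimination: row p clears the first coordinate of the other rows.
reduced-dependent⇒dependent : (v : Fin (suc k) → Fin (suc r) → ℚ) (p : Fin (suc k)) (μ : Fin k → ℚ) →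
  (∀ j → v (punchIn p j) 0F ≡ μ j * v p 0F) →
  Dependent (λ j i → v (punchIn p j) (F.suc i) - μ j * v p (F.suc i)) → Dependent v
reduced-dependent⇒dependent v p μ v≡μv (c , (j , cj≢0) , rel) = d , (punchIn p j , dpj≢0) , relᵈ
  where
  s : ℚ
  s = sumFin (λ j → - (c j * μ j))
  d : Fin _ → ℚ
  d = insertAt c p s
  dpj≢0 : d (punchIn p j) ≢ 0ℚ
  dpj≢0 dpj≡0 = cj≢0 (trans (sym (insertAt-punchIn c p s j)) dpj≡0)
  reduce : ∀ i → sumFin (λ k → d k * v k i) ≡ sumFin (λ j → c j * (v (punchIn p j) i - μ j * v p i))
  reduce i = begin
    sumFin (λ k → d k * v k i)
      ≡⟨ sumFin-remove (λ k → d k * v k i) p ⟩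
    d p * v p i + sumFin (λ j → d (punchIn p j) * v (punchIn p j) i)
      ≡⟨ cong₂ _+_ (cong (_* v p i) (insertAt-lookup c p s))
                   (sumFin-cong (λ j → cong (_* v (punchIn p j) i) (insertAt-punchIn c p s j))) ⟩
    s * v p i + sumFin (λ j → c j * v (punchIn p j) i)
      ≡⟨ cong (_+ sumFin (λ j → c j * v (punchIn p j) i)) (sumFin-*ʳ (v p i) (λ j → - (c j * μ j))) ⟩
    sumFin (λ j → - (c j * μ j) * v p i) + sumFin (λ j → c j * v (punchIn p j) i)
      ≡⟨ sumFin-+ (λ j → - (c j * μ j) * v p i) (λ j → c j * v (punchIn p j) i) ⟨
    sumFin (λ j → - (c j * μ j) * v p i + c j * v (punchIn p j) i)
      ≡⟨ sumFin-cong (λ j → regroup (c j) (μ j) (v p i) (v (punchIn p j) i)) ⟩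
    sumFin (λ j → c j * (v (punchIn p j) i - μ j * v p i)) ∎
    where
    regroup : ∀ c μ x y → - (c * μ) * x + c * y ≡ c * (y - μ * x)
    regroup = solve 4 (λ c μ x y → (:- (c :* μ)) :* x :+ c :* y := c :* (y :- μ :* x)) refl
  relᵈ : ∀ i → sumFin (λ k → d k * v k i) ≡ 0ℚ
  relᵈ 0F        = trans (reduce 0F) (sumFin-zero (λ j → begin
    c j * (v (punchIn p j) 0F - μ j * v p 0F) ≡⟨ cong (λ y → c j * (y - μ j * v p 0F)) (v≡μv j) ⟩
    c j * (μ j * v p 0F - μ j * v p 0F)       ≡⟨ cong (c j *_) (+-inverseʳ (μ j * v p 0F)) ⟩
    c j * 0ℚ                                  ≡⟨ *-zeroʳ (c j) ⟩
    0ℚ                                        ∎))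
  relᵈ (F.suc i) = trans (reduce (F.suc i)) (rel i)

suc-vectors-dependent : (v : Fin (suc r) → Fin r → ℚ) → Dependent v
suc-vectors-dependent {zero}  v = (λ _ → 1ℚ) , (0F , 1≢0) , λ ()
suc-vectors-dependent {suc r} v with pivot v
... | p , μ , v≡μv = reduced-dependent⇒dependent v p μ v≡μv
  (suc-vectors-dependent (λ j i → v (punchIn p j) (F.suc i) - μ j * v p (F.suc i)))

δ : Fin r → Fin r → ℚ
δ j i = if does (i F.≟ j) then 1ℚ else 0ℚ

δ-diag : (j : Fin r) → δ j j ≡ 1ℚ
δ-diag j = cong (if_then 1ℚ else 0ℚ) (dec-true (j F.≟ j) refl)

δ-off : {i j : Fin r} → i ≢ j → δ j i ≡ 0ℚ
δ-off {i = i} {j} i≢j = cong (if_then 1ℚ else 0ℚ) (dec-false (i F.≟ j) i≢j)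

record InSpan (u : Fin r → R → ℚ) (v : R → ℚ) : Set where
  constructor _,_
  field
    coefficients : Fin r → ℚ
    expansion    : ∀ x → v x ≡ sumFin (λ i → coefficients i * u i x)

module _ {u : Fin r → R → ℚ} where

  inSpan-cong : {v w : R → ℚ} → (∀ x → v x ≡ w x) → InSpan u v → InSpan u w
  inSpan-cong v≗w (κ , v≡κu) = κ , λ x → trans (sym (v≗w x)) (v≡κu x)

  inSpan-zero : InSpan u (λ _ → 0ℚ)
  inSpan-zero = (λ _ → 0ℚ) , λ x → sym (sumFin-zero (λ i → *-zeroˡ (u i x)))

  inSpan-member : ∀ j → InSpan u (u j)
  inSpan-member j = δ j , λ x → sym (begin
    sumFin (λ i → δ j i * u i x) ≡⟨ sumFin-single (λ i → δ j i * u i x) j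
                                      (λ i i≢j → trans (cong (_* u i x) (δ-off i≢j)) (*-zeroˡ (u i x))) ⟩
    δ j j * u j x                ≡⟨ cong (_* u j x) (δ-diag j) ⟩
    1ℚ * u j x                   ≡⟨ *-identityˡ (u j x) ⟩
    u j x                        ∎)

  inSpan-+ : {v w : R → ℚ} → InSpan u v → InSpan u w → InSpan u (λ x → v x + w x)
  inSpan-+ {v} {w} (κ , v≡κu) (λ′ , w≡λ′u) = (λ i → κ i + λ′ i) , λ x → begin
    v x + w x
      ≡⟨ cong₂ _+_ (v≡κu x) (w≡λ′u x) ⟩
    sumFin (λ i → κ i * u i x) + sumFin (λ i → λ′ i * u i x)
      ≡⟨ sumFin-+ (λ i → κ i * u i x) (λ i → λ′ i * u i x) ⟨
    sumFin (λ i → κ i * u i x + λ′ i * u i x)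
      ≡⟨ sumFin-cong (λ i → *-distribʳ-+ (u i x) (κ i) (λ′ i)) ⟨
    sumFin (λ i → (κ i + λ′ i) * u i x) ∎

  inSpan-* : {v : R → ℚ} (a : ℚ) → InSpan u v → InSpan u (λ x → a * v x)
  inSpan-* {v} a (κ , v≡κu) = (λ i → a * κ i) , λ x → begin
    a * v x                          ≡⟨ cong (a *_) (v≡κu x) ⟩
    a * sumFin (λ i → κ i * u i x)   ≡⟨ sumFin-*ˡ a (λ i → κ i * u i x) ⟩
    sumFin (λ i → a * (κ i * u i x)) ≡⟨ sumFin-cong (λ i → *-assoc a (κ i) (u i x)) ⟨
    sumFin (λ i → a * κ i * u i x)   ∎

  inSpan-- : {v w : R → ℚ} → InSpan u v → InSpan u w → InSpan u (λ x → v x - w x)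
  inSpan-- {v} {w} v∈ w∈ = inSpan-cong (λ x → cong (v x +_) (-1*w≡-w (w x))) (inSpan-+ v∈ (inSpan-* (- 1ℚ) w∈))
    where
    -1*w≡-w : ∀ w → - 1ℚ * w ≡ - w
    -1*w≡-w w = trans (sym (neg-distribˡ-* 1ℚ w)) (cong -_ (*-identityˡ w))

  inSpan-sumFin : {v : Fin k → R → ℚ} → (∀ j → InSpan u (v j)) → InSpan u (λ x → sumFin (λ j → v j x))
  inSpan-sumFin {zero}  v∈ = inSpan-zero
  inSpan-sumFin {suc k} v∈ = inSpan-+ (v∈ 0F) (inSpan-sumFin (λ j → v∈ (F.suc j)))

inSpan⇒¬linIndep : (A : Matrix R C) (u : Fin r → R → ℚ) → (∀ t → InSpan u (λ x → A x t)) →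
  (f : Fin (suc r) → C) → ¬ LinIndepCols A f
inSpan⇒¬linIndep A u span f indep with suc-vectors-dependent (λ j → InSpan.coefficients (span (f j)))
... | c , (j , cj≢0) , rel = cj≢0 (indep c vanish j)
  where
  κ : Fin _ → Fin _ → ℚ
  κ j = InSpan.coefficients (span (f j))
  vanish : ∀ x → sumFin (λ j → c j * A x (f j)) ≡ 0ℚ
  vanish x = begin
    sumFin (λ j → c j * A x (f j))
      ≡⟨ sumFin-cong (λ j → cong (c j *_) (InSpan.expansion (span (f j)) x)) ⟩
    sumFin (λ j → c j * sumFin (λ i → κ j i * u i x))
      ≡⟨ sumFin-exchange c (λ j i → κ j i * u i x) ⟩
    sumFin (λ i → sumFin (λ j → c j * (κ j i * u i x)))
      ≡⟨ sumFin-cong (λ i → sumFin-cong (λ j → *-assoc (c j) (κ j i) (u i x))) ⟨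
    sumFin (λ i → sumFin (λ j → c j * κ j i * u i x))
      ≡⟨ sumFin-cong (λ i → sumFin-*ʳ (u i x) (λ j → c j * κ j i)) ⟨
    sumFin (λ i → sumFin (λ j → c j * κ j i) * u i x)
      ≡⟨ sumFin-zero (λ i → trans (cong (_* u i x) (rel i)) (*-zeroˡ (u i x))) ⟩
    0ℚ ∎

linIndep⇒injective : (A : Matrix R C) (f : Fin r → C) → LinIndepCols A f → Injective _≡_ _≡_ f
linIndep⇒injective A f indep {i} {j} fi≡fj with i F.≟ j
... | yes i≡j = i≡j
... | no i≢j  = ⊥-elim (1≢0 (trans (sym κi≡1) (indep κ vanish i)))
  where
  column : Fin _ → _ → ℚ
  column k x = A x (f k)
  difference : InSpan column (λ x → column i x - column j x)
  difference = inSpan-- (inSpan-member i) (inSpan-member j)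
  κ : Fin _ → ℚ
  κ = InSpan.coefficients difference
  κi≡1 : κ i ≡ 1ℚ
  κi≡1 = cong₂ (λ a b → a + - 1ℚ * b) (δ-diag i) (δ-off i≢j)
  vanish : ∀ x → sumFin (λ k → κ k * A x (f k)) ≡ 0ℚ
  vanish x = begin
    sumFin (λ k → κ k * A x (f k)) ≡⟨ InSpan.expansion difference x ⟨
    A x (f i) - A x (f j)           ≡⟨ cong (λ t → A x (f i) - A x t) fi≡fj ⟨
    A x (f i) - A x (f i)           ≡⟨ +-inverseʳ (A x (f i)) ⟩
    0ℚ                              ∎

triangular⇒linIndep : (A : Matrix R C) (f : Fin r → C) (ρ : Fin r → R) (h : Fin r → ℕ) →
  (∀ i → A (ρ i) (f i) ≢ 0ℚ) → (∀ i j → A (ρ j) (f i) ≢ 0ℚ → i ≡ j ⊎ h i < h j) →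
  LinIndepCols A f
triangular⇒linIndep A f ρ h diagonal triangular c rel =
  All.wfRec (On.wellFounded h <-wellFounded) _ (λ j → c j ≡ 0ℚ) step
  where
  step : ∀ j → (∀ {i} → h i < h j → c i ≡ 0ℚ) → c j ≡ 0ℚ
  step j below = [ id , ⊥-elim ∘ diagonal j ]′ (p*q≡0⇒p≡0∨q≡0 (c j) (A (ρ j) (f j)) diagonalTerm≡0)
    where
    offDiagonal : ∀ i → i ≢ j → c i * A (ρ j) (f i) ≡ 0ℚ
    offDiagonal i i≢j with A (ρ j) (f i) ≟ 0ℚ
    ... | yes a≡0 = trans (cong (c i *_) a≡0) (*-zeroʳ (c i))
    ... | no a≢0 with triangular i j a≢0
    ...   | inj₁ i≡j   = ⊥-elim (i≢j i≡j)
    ...   | inj₂ hi<hj = trans (cong (_* A (ρ j) (f i)) (below {i} hi<hj)) (*-zeroˡ (A (ρ j) (f i)))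
    diagonalTerm≡0 : c j * A (ρ j) (f j) ≡ 0ℚ
    diagonalTerm≡0 = trans (sym (sumFin-single _ j offDiagonal)) (rel (ρ j))

hasRank-intro : (A : Matrix R C) (f : Fin r → C) (u : Fin r → R → ℚ) →
  LinIndepCols A f → (∀ t → InSpan u (λ x → A x t)) → HasRank A r
hasRank-intro A f u indep span =
  (f , linIndep⇒injective A f indep , indep) , λ g _ → inSpan⇒¬linIndep A u span g

triangle : ∀ {n} → Fin n → Fin n → Fin n → Triangle n
triangle a b c 0F = a
triangle a b c 1F = b
triangle a b c 2F = c

_⊆_ : ∀ {n} → Edge n → Triangle n → Set
edge (p , α) (q , β) _ ⊆ t = t p ≡ α × t q ≡ β

indicator≢0 : ∀ b₁ b₂ → (if b₁ ∧ b₂ then 1ℚ else 0ℚ) ≢ 0ℚ → T b₁ × T b₂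
indicator≢0 true  true  _  = tt , tt
indicator≢0 true  false ≢0 = ⊥-elim (≢0 refl)
indicator≢0 false _     ≢0 = ⊥-elim (≢0 refl)

W≢0⇒⊆ : ∀ {n} (e : Edge n) (t : Triangle n) → W n e t ≢ 0ℚ → e ⊆ t
W≢0⇒⊆ (edge (p , α) (q , β) _) t W≢0 with indicator≢0 ⌊ t p F.≟ α ⌋ ⌊ t q F.≟ β ⌋ W≢0
... | tp≡α , tq≡β = toWitness tp≡α , toWitness tq≡β

⊆⇒W≡1 : ∀ {n} (e : Edge n) (t : Triangle n) → e ⊆ t → W n e t ≡ 1ℚ
⊆⇒W≡1 (edge (p , α) (q , β) _) t (tp≡α , tq≡β) =
  cong₂ (λ b₁ b₂ → if b₁ ∧ b₂ then 1ℚ else 0ℚ)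
    (trans (isYes≗does (t p F.≟ α)) (dec-true (t p F.≟ α) tp≡α))
    (trans (isYes≗does (t q F.≟ β)) (dec-true (t q F.≟ β) tq≡β))

W-cong : ∀ {n} (e : Edge n) {t t′ : Triangle n} → t ≗ t′ → W n e t ≡ W n e t′
W-cong (edge (p , α) (q , β) _) t≗t′ =
  cong₂ (λ a b → if ⌊ a F.≟ α ⌋ ∧ ⌊ b F.≟ β ⌋ then 1ℚ else 0ℚ) (t≗t′ p) (t≗t′ q)

-- W n e t only depends on the two coordinates of t in the parts of e, so in each case the
-- identity involves just four distinct values.
W-inclusion–exclusion : ∀ {n} (e : Edge (suc n)) (t : Triangle (suc n)) →
  let a = t 0F; b = t 1F; c = t 2F; w = W (suc n) e in
  w t ≡ w (triangle a b 0F) + w (triangle a 0F c) + w (triangle 0F b c)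
        - w (triangle a 0F 0F) - w (triangle 0F b 0F) - w (triangle 0F 0F c) + w (triangle 0F 0F 0F)
W-inclusion–exclusion e@(edge (0F , _) (1F , _) _) t =
  solve 4 (λ x y z u → x := x :+ y :+ z :- y :- z :- u :+ u) refl
    (W _ e t) (W _ e (triangle (t 0F) 0F 0F)) (W _ e (triangle 0F (t 1F) 0F)) (W _ e (triangle 0F 0F 0F))
W-inclusion–exclusion e@(edge (0F , _) (2F , _) _) t =
  solve 4 (λ x y z u → x := y :+ x :+ z :- y :- u :- z :+ u) refl
    (W _ e t) (W _ e (triangle (t 0F) 0F 0F)) (W _ e (triangle 0F 0F (t 2F))) (W _ e (triangle 0F 0F 0F))
W-inclusion–exclusion e@(edge (1F , _) (2F , _) _) t =
  solve 4 (λ x y z u → x := y :+ z :+ x :- u :- y :- z :+ u) refl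
    (W _ e t) (W _ e (triangle 0F (t 1F) 0F)) (W _ e (triangle 0F 0F (t 2F))) (W _ e (triangle 0F 0F 0F))
W-inclusion–exclusion (edge (0F , _) (0F , _) ())
W-inclusion–exclusion (edge (1F , _) (0F , _) ())
W-inclusion–exclusion (edge (1F , _) (1F , _) (s≤s ()))
W-inclusion–exclusion (edge (2F , _) (0F , _) ())
W-inclusion–exclusion (edge (2F , _) (1F , _) (s≤s ()))
W-inclusion–exclusion (edge (2F , _) (2F , _) (s≤s (s≤s ())))

sumTri-cong : ∀ {n} {f g : Triangle n → ℚ} → (∀ t → f t ≡ g t) → sumTri f ≡ sumTri g
sumTri-cong {n} f≗g = sumFin-cong {r = n} λ a → sumFin-cong {r = n} λ b → sumFin-cong {r = n} λ c → f≗g _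

sumTri-exchange : ∀ {n k} (c : Fin k → ℚ) (g : Fin k → Triangle n → ℚ) →
  sumFin (λ j → c j * sumTri (g j)) ≡ sumTri (λ t → sumFin (λ j → c j * g j t))
sumTri-exchange {n} c g = trans (sumFin-exchange {r = n} c _)
  (sumFin-cong {r = n} λ a → trans (sumFin-exchange {r = n} c _)
    (sumFin-cong {r = n} λ b → sumFin-exchange {r = n} c _))

-- The triangles built inside sumTri are only pointwise equal to triangle a b c (there is no
-- function extensionality), hence the invariance hypotheses on f.
sumTri-triangle : ∀ {n} (f : Triangle n → ℚ) → (∀ {t t′} → t ≗ t′ → f t ≡ f t′) →
  sumTri f ≡ sumFin (λ a → sumFin (λ b → sumFin (λ c → f (triangle a b c))))
sumTri-triangle {n} f f-cong =
  sumFin-cong {r = n} λ a → sumFin-cong {r = n} λ b → sumFin-cong {r = n} λ c →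
    f-cong (λ { 0F → refl ; 1F → refl ; 2F → refl })

sumTri≡0⇒≡0 : ∀ {n} (f : Triangle n → ℚ) → (∀ {t t′} → t ≗ t′ → f t ≡ f t′) →
  (∀ t → 0ℚ ≤ f t) → sumTri f ≡ 0ℚ → ∀ t → f t ≡ 0ℚ
sumTri≡0⇒≡0 {n} f f-cong f≥0 Σf≡0 t =
  trans (f-cong (λ { 0F → refl ; 1F → refl ; 2F → refl }))
    (sumFin≡0⇒≡0 {r = n} (λ c → f≥0 _)
      (sumFin≡0⇒≡0 {r = n} (λ b → sumFin-nonNeg {r = n} (λ c → f≥0 _))
        (sumFin≡0⇒≡0 {r = n} (λ a → sumFin-nonNeg {r = n} (λ b → sumFin-nonNeg {r = n} (λ c → f≥0 _))) Σf≡0 (t 0F))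
        (t 1F))
      (t 2F))

M-column-inSpan : ∀ {n r} {u : Fin r → Edge n → ℚ} →
  (∀ t → InSpan u (λ x → W n x t)) → ∀ e → InSpan u (λ x → M n x e)
M-column-inSpan {n} {u = u} span e =
  inSpan-cong (λ x → sym (sumTri-triangle (λ t → W n x t * W n e t)
                            (λ t≗t′ → cong₂ _*_ (W-cong x t≗t′) (W-cong e t≗t′))))
    (inSpan-sumFin λ a → inSpan-sumFin λ b → inSpan-sumFin λ c → term (triangle a b c))
  where
  term : ∀ t → InSpan u (λ x → W n x t * W n e t)
  term t = inSpan-cong (λ x → *-comm (W n e t) (W n x t)) (inSpan-* (W n e t) (span t))

M-linIndep : ∀ {n k} (f : Fin k → Edge n) → LinIndepCols (λ t e → W n e t) f → LinIndepCols (M n) f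
M-linIndep {n} f rows-indep c Mc≡0 = rows-indep c (λ t → p*p≡0⇒p≡0 (Y t)
  (sumTri≡0⇒≡0 (λ t → Y t * Y t) (λ t≗t′ → cong₂ _*_ (Y-cong t≗t′) (Y-cong t≗t′))
    (λ t → p*p≥0 (Y t)) ΣY²≡0 t))
  where
  Y : Triangle n → ℚ
  Y t = sumFin (λ j → c j * W n (f j) t)
  Y-cong : ∀ {t t′} → t ≗ t′ → Y t ≡ Y t′
  Y-cong t≗t′ = sumFin-cong (λ j → cong (c j *_) (W-cong (f j) t≗t′))
  Mc≡ΣWY : ∀ x → sumFin (λ j → c j * M n x (f j)) ≡ sumTri (λ t → W n x t * Y t)
  Mc≡ΣWY x = begin
    sumFin (λ j → c j * M n x (f j))
      ≡⟨ sumTri-exchange c (λ j t → W n x t * W n (f j) t) ⟩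
    sumTri (λ t → sumFin (λ j → c j * (W n x t * W n (f j) t)))
      ≡⟨ sumTri-cong (λ t → trans (sumFin-cong (λ j → x∙yz≈y∙xz (c j) (W n x t) (W n (f j) t)))
                                  (sym (sumFin-*ˡ (W n x t) (λ j → c j * W n (f j) t)))) ⟩
    sumTri (λ t → W n x t * Y t) ∎
  ΣY²≡0 : sumTri (λ t → Y t * Y t) ≡ 0ℚ
  ΣY²≡0 = begin
    sumTri (λ t → Y t * Y t)
      ≡⟨ sumTri-cong (λ t → trans (sumFin-*ʳ (Y t) (λ j → c j * W n (f j) t))
                                  (sumFin-cong λ j → *-assoc (c j) (W n (f j) t) (Y t))) ⟩
    sumTri (λ t → sumFin (λ j → c j * (W n (f j) t * Y t)))
      ≡⟨ sumTri-exchange c (λ j t → W n (f j) t * Y t) ⟨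
    sumFin (λ j → c j * sumTri (λ t → W n (f j) t * Y t))
      ≡⟨ sumFin-cong (λ j → cong (c j *_) (Mc≡ΣWY (f j))) ⟨
    sumFin (λ j → c j * sumFin (λ i → c i * M n (f j) (f i)))
      ≡⟨ sumFin-zero (λ j → trans (cong (c j *_) (Mc≡0 (f j))) (*-zeroʳ (c j))) ⟩
    0ℚ ∎

module _ (m : ℕ) where

  private
    n : ℕ
    n = suc m

  -- B = {(a,b,0)} ∪ {(a,0,c+1)} ∪ {(0,b+1,c+1)}, of levels 0, 1, 2.
  Basis : Set
  Basis = (Fin n × Fin n) ⊎ (Fin n × Fin m) ⊎ (Fin m × Fin m)

  basisTriangle : Basis → Triangle n
  basisTriangle (inj₁ (a , b))        = triangle a b 0F
  basisTriangle (inj₂ (inj₁ (a , c))) = triangle a 0F (F.suc c)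
  basisTriangle (inj₂ (inj₂ (b , c))) = triangle 0F (F.suc b) (F.suc c)

  basisEdge : Basis → Edge n
  basisEdge (inj₁ (a , b))        = edge (0F , a) (1F , b) (s≤s z≤n)
  basisEdge (inj₂ (inj₁ (a , c))) = edge (0F , a) (2F , F.suc c) (s≤s z≤n)
  basisEdge (inj₂ (inj₂ (b , c))) = edge (1F , F.suc b) (2F , F.suc c) (s≤s (s≤s z≤n))

  level : Basis → ℕ
  level (inj₁ _)        = 0
  level (inj₂ (inj₁ _)) = 1
  level (inj₂ (inj₂ _)) = 2

  level≤2 : ∀ y → level y ℕ.≤ 2
  level≤2 (inj₁ _)        = z≤n
  level≤2 (inj₂ (inj₁ _)) = s≤s z≤n
  level≤2 (inj₂ (inj₂ _)) = s≤s (s≤s z≤n)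

  basisEdge⊆basisTriangle : ∀ y → basisEdge y ⊆ basisTriangle y
  basisEdge⊆basisTriangle (inj₁ _)        = refl , refl
  basisEdge⊆basisTriangle (inj₂ (inj₁ _)) = refl , refl
  basisEdge⊆basisTriangle (inj₂ (inj₂ _)) = refl , refl

  basisEdge⊆basisTriangle⇒≡⊎level< : ∀ x y → basisEdge y ⊆ basisTriangle x → x ≡ y ⊎ level y < level x
  basisEdge⊆basisTriangle⇒≡⊎level< (inj₁ _)        (inj₁ _)        (refl , refl) = inj₁ refl
  basisEdge⊆basisTriangle⇒≡⊎level< (inj₁ _)        (inj₂ (inj₁ _)) (_ , ())
  basisEdge⊆basisTriangle⇒≡⊎level< (inj₁ _)        (inj₂ (inj₂ _)) (_ , ())
  basisEdge⊆basisTriangle⇒≡⊎level< (inj₂ (inj₁ _)) (inj₁ _)        _             = inj₂ (s≤s z≤n)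
  basisEdge⊆basisTriangle⇒≡⊎level< (inj₂ (inj₁ _)) (inj₂ (inj₁ _)) (refl , refl) = inj₁ refl
  basisEdge⊆basisTriangle⇒≡⊎level< (inj₂ (inj₁ _)) (inj₂ (inj₂ _)) (() , _)
  basisEdge⊆basisTriangle⇒≡⊎level< (inj₂ (inj₂ _)) (inj₁ _)        _             = inj₂ (s≤s z≤n)
  basisEdge⊆basisTriangle⇒≡⊎level< (inj₂ (inj₂ _)) (inj₂ (inj₁ _)) _             = inj₂ (s≤s (s≤s z≤n))
  basisEdge⊆basisTriangle⇒≡⊎level< (inj₂ (inj₂ _)) (inj₂ (inj₂ _)) (refl , refl) = inj₁ refl

  basisSize : ℕ
  basisSize = n ℕ.* n ℕ.+ (n ℕ.* m ℕ.+ m ℕ.* m)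

  enumeration : Fin basisSize ↔ Basis
  enumeration = ↔-trans +↔⊎ (*↔× ⊎-↔ ↔-trans +↔⊎ (*↔× ⊎-↔ *↔×))

  open Inverse enumeration using (to; from; strictlyInverseˡ; strictlyInverseʳ)

  to-injective : ∀ {i j} → to i ≡ to j → i ≡ j
  to-injective {i} {j} eq = trans (sym (strictlyInverseʳ i)) (trans (cong from eq) (strictlyInverseʳ j))

  basisTriangles : Fin basisSize → Triangle n
  basisTriangles = basisTriangle ∘ to

  basisEdges : Fin basisSize → Edge n
  basisEdges = basisEdge ∘ to

  basisColumns : Fin basisSize → Edge n → ℚ
  basisColumns i x = W n x (basisTriangles i)

  W-basisEdge-basisTriangle≢0 : ∀ i → W n (basisEdges i) (basisTriangles i) ≢ 0ℚ
  W-basisEdge-basisTriangle≢0 i W≡0 = 1≢0 (trans (sym (⊆⇒W≡1 (basisEdges i) (basisTriangles i) (basisEdge⊆basisTriangle (to i)))) W≡0)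

  W-basisColumns-linIndep : LinIndepCols (W n) basisTriangles
  W-basisColumns-linIndep =
    triangular⇒linIndep (W n) basisTriangles basisEdges (λ i → 2 ∸ level (to i)) W-basisEdge-basisTriangle≢0 below
    where
    below : ∀ i j → W n (basisEdges j) (basisTriangles i) ≢ 0ℚ → i ≡ j ⊎ 2 ∸ level (to i) < 2 ∸ level (to j)
    below i j W≢0 with basisEdge⊆basisTriangle⇒≡⊎level< (to i) (to j) (W≢0⇒⊆ (basisEdges j) (basisTriangles i) W≢0)
    ... | inj₁ eq = inj₁ (to-injective eq)
    ... | inj₂ lt = inj₂ (∸-monoʳ-< lt (level≤2 (to i)))

  W-basisRows-linIndep : LinIndepCols (λ t e → W n e t) basisEdges
  W-basisRows-linIndep =
    triangular⇒linIndep (λ t e → W n e t) basisEdges basisTriangles (level ∘ to) W-basisEdge-basisTriangle≢0 below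
    where
    below : ∀ i j → W n (basisEdges i) (basisTriangles j) ≢ 0ℚ → i ≡ j ⊎ level (to i) < level (to j)
    below i j W≢0 with basisEdge⊆basisTriangle⇒≡⊎level< (to j) (to i) (W≢0⇒⊆ (basisEdges i) (basisTriangles j) W≢0)
    ... | inj₁ eq = inj₁ (sym (to-injective eq))
    ... | inj₂ lt = inj₂ lt

  basisTriangle-inSpan : ∀ y → InSpan basisColumns (λ x → W n x (basisTriangle y))
  basisTriangle-inSpan y =
    inSpan-cong (λ x → cong (W n x ∘ basisTriangle) (strictlyInverseˡ y)) (inSpan-member (from y))

  triangle-a0c-inSpan : ∀ a c → InSpan basisColumns (λ x → W n x (triangle a 0F c))
  triangle-a0c-inSpan a 0F        = basisTriangle-inSpan (inj₁ (a , 0F))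
  triangle-a0c-inSpan a (F.suc c) = basisTriangle-inSpan (inj₂ (inj₁ (a , c)))

  triangle-0bc-inSpan : ∀ b c → InSpan basisColumns (λ x → W n x (triangle 0F b c))
  triangle-0bc-inSpan b         0F        = basisTriangle-inSpan (inj₁ (0F , b))
  triangle-0bc-inSpan 0F        (F.suc c) = basisTriangle-inSpan (inj₂ (inj₁ (0F , c)))
  triangle-0bc-inSpan (F.suc b) (F.suc c) = basisTriangle-inSpan (inj₂ (inj₂ (b , c)))

  W-column-inSpan : ∀ t → InSpan basisColumns (λ x → W n x t)
  W-column-inSpan t =
    inSpan-cong (λ x → sym (W-inclusion–exclusion x t))
      (inSpan-+ (inSpan-- (inSpan-- (inSpan-- (inSpan-+ (inSpan-+
        (basisTriangle-inSpan (inj₁ (a , b)))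
        (triangle-a0c-inSpan a c))
        (triangle-0bc-inSpan b c))
        (triangle-a0c-inSpan a 0F))
        (triangle-0bc-inSpan b 0F))
        (triangle-0bc-inSpan 0F c))
        (triangle-0bc-inSpan 0F 0F))
    where
    a b c : Fin n
    a = t 0F
    b = t 1F
    c = t 2F

  W-hasRank : HasRank (W n) basisSize
  W-hasRank = hasRank-intro (W n) basisTriangles basisColumns W-basisColumns-linIndep W-column-inSpan

  M-hasRank : HasRank (M n) basisSize
  M-hasRank = hasRank-intro (M n) basisEdges basisColumns
    (M-linIndep basisEdges W-basisRows-linIndep) (M-column-inSpan W-column-inSpan)

-- The cubes are written out as _^_ unfolds them, which the ring tactic can read.
cube-difference≡basisSize : ∀ m → suc m ^ 3 ∸ m ^ 3 ≡ basisSize m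
cube-difference≡basisSize m = trans (cong (_∸ m ^ 3) (expand m)) (m+n∸n≡m (basisSize m) (m ^ 3))
  where
  expand : ∀ m → suc m ℕ.* (suc m ℕ.* (suc m ℕ.* 1))
               ≡ suc m ℕ.* suc m ℕ.+ (suc m ℕ.* m ℕ.+ m ℕ.* m) ℕ.+ m ℕ.* (m ℕ.* (m ℕ.* 1))
  expand = solve-∀

proposition2p3 : (n : ℕ) → 1 ℕ.≤ n →
    HasRank (W n) (n ^ 3 ∸ (n ∸ 1) ^ 3) × HasRank (M n) (n ^ 3 ∸ (n ∸ 1) ^ 3)
proposition2p3 (suc m) _ rewrite cube-difference≡basisSize m = W-hasRank m , M-hasRank m
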